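{- Let $\mathcal{C}$ be a finite set of complementive constraints and let $S(x_1,\dots,x_n,0,1)$ be a set of constraint applications of $\mathcal{C}$ with constants. Then for any quantifiers $Q_1,\dots,Q_n\in\{\exists,\forall\}$, $Q_1x_1Q_2x_2 \cdots Q_nx_n\, S(x_1,\dots,x_n,0,1)$ is true if and only if $Q_1x_1Q_2x_2 \cdots Q_nx_n\, S(x_1,\dots,x_n,1,0)$ is true.
   Context: A constraint of arity $k>0$ is a Boolean function $C:\{0,1\}^k\to\{0,1\}$; it is complementive if $C(s)=C(\overline{s})$ for all $s\in\{0,1\}^k$, where $\overline{s}=(1-s_1)\cdots(1-s_k)$. A constraint application with constants is $C(z_1,\dots,z_k)$ with each $z_j$ a variable or a constant $0$ or $1$. The notation $S(x_1,\dots,x_n,0,1)$ regards $S$ as a set (conjunction) of constraint applications over the variables $x_1,\dots,x_n$ and two placeholder arguments $f,t$, with $0$ substituted for $f$ and $1$ for $t$; $S(x_1,\dots,x_n,1,0)$ denotes the same set with every occurrence of the constant $0$ replaced by $1$ and vice versa. -}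

module Defs where

open import Data.Nat using (ℕ; zero; suc)
open import Data.Bool using (Bool; true; false; not; _∧_; _∨_)
open import Data.Fin using (Fin)
open import Data.Vec using (Vec; []; _∷_; map; lookup)
open import Data.List using (List)
open import Data.Product using (Σ; _,_; proj₁; proj₂)
open import Data.Sum using (_⊎_; inj₁; inj₂)
open import Data.List.Relation.Unary.All using (All)
open import Data.List.Membership.Propositional using (_∈_)
open import Relation.Binary.PropositionalEquality using (_≡_)

Constraint : ℕ → Set
Constraint k = Vec Bool k → Bool

Constr : Set
Constr = Σ ℕ (λ m → Constraint (suc m))

Complementive : Constr → Set
Complementive (m , C) = ∀ (s : Vec Bool (suc m)) → C s ≡ C (map not s)

-- An argument position: a variable x_i, or a constant (false = 0, true = 1).
Arg : ℕ → Set
Arg n = Fin n ⊎ Bool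

record Application (𝒞 : List Constr) (n : ℕ) : Set where
  constructor app
  field
    constr : Constr
    inSet  : constr ∈ 𝒞
    args   : Vec (Arg n) (suc (proj₁ constr))

ConstraintSet : List Constr → ℕ → Set
ConstraintSet 𝒞 n = List (Application 𝒞 n)

-- Evaluate an argument under an assignment, with given values for the
-- placeholders f (constant 0) and t (constant 1).
evalArg : ∀ {n} → Bool → Bool → Vec Bool n → Arg n → Bool
evalArg f t σ (inj₁ i)     = lookup σ i
evalArg f t σ (inj₂ false) = f
evalArg f t σ (inj₂ true)  = t

evalApp : ∀ {𝒞 n} → Bool → Bool → Vec Bool n → Application 𝒞 n → Bool
evalApp f t σ (app (m , C) _ as) = C (map (evalArg f t σ) as)

evalS : ∀ {𝒞 n} → ConstraintSet 𝒞 n → Bool → Bool → Vec Bool n → Bool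
evalS List.[] f t σ = true
evalS (a List.∷ S) f t σ = evalApp f t σ a ∧ evalS S f t σ

data Quantifier : Set where
  ∃q ∀q : Quantifier

-- Truth of  Q_1 x_1 … Q_n x_n φ(x_1,…,x_n),  x_1 outermost.
evalQ : ∀ {n} → Vec Quantifier n → (Vec Bool n → Bool) → Bool
evalQ [] φ = φ []
evalQ (∃q ∷ Qs) φ = evalQ Qs (λ σ → φ (false ∷ σ)) ∨ evalQ Qs (λ σ → φ (true ∷ σ))
evalQ (∀q ∷ Qs) φ = evalQ Qs (λ σ → φ (false ∷ σ)) ∧ evalQ Qs (λ σ → φ (true ∷ σ))

{-# OPTIONS --safe #-}
-- Complementing every variable while swapping the constants 0 and 1 complements
-- every argument of every application, which a complementive constraint does not
-- notice. Complementing the bound variables of a quantifier prefix only swaps the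
-- two branches of each ∨ or ∧, so it does not change the truth value either.
module Submission where

open import Defs
open import Data.Nat using (ℕ)
open import Data.Bool using (Bool; true; false; not; _∧_; _∨_)
open import Data.Bool.Properties using (∨-comm; ∧-comm)
open import Data.Vec using (Vec; []; _∷_; map)
open import Data.Vec.Properties using (lookup-map; map-∘; map-cong)
open import Data.List using (List; []; _∷_)
open import Data.List.Relation.Unary.All as All using (All)
open import Data.Sum using (inj₁; inj₂)
open import Data.Product using (_,_)
open import Function.Base using (_∘_)
open import Function.Bundles using (_⇔_; mk⇔)
open import Relation.Binary.PropositionalEquality using (_≡_; refl; sym; trans; cong; cong₂)
open Relation.Binary.PropositionalEquality.≡-Reasoning

evalQ-cong : ∀ {n} (Qs : Vec Quantifier n) {φ ψ : Vec Bool n → Bool} →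
             (∀ σ → φ σ ≡ ψ σ) → evalQ Qs φ ≡ evalQ Qs ψ
evalQ-cong []        φ≗ψ = φ≗ψ []
evalQ-cong (∃q ∷ Qs) φ≗ψ =
  cong₂ _∨_ (evalQ-cong Qs (φ≗ψ ∘ (false ∷_))) (evalQ-cong Qs (φ≗ψ ∘ (true ∷_)))
evalQ-cong (∀q ∷ Qs) φ≗ψ =
  cong₂ _∧_ (evalQ-cong Qs (φ≗ψ ∘ (false ∷_))) (evalQ-cong Qs (φ≗ψ ∘ (true ∷_)))

evalQ-∘-map-not : ∀ {n} (Qs : Vec Quantifier n) (φ : Vec Bool n → Bool) →
                  evalQ Qs (φ ∘ map not) ≡ evalQ Qs φ
evalQ-∘-map-not []        φ = refl
evalQ-∘-map-not (∃q ∷ Qs) φ = begin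
  evalQ Qs (φ ∘ map not ∘ (false ∷_)) ∨ evalQ Qs (φ ∘ map not ∘ (true ∷_))
    ≡⟨ cong₂ _∨_ (evalQ-∘-map-not Qs (φ ∘ (true ∷_))) (evalQ-∘-map-not Qs (φ ∘ (false ∷_))) ⟩
  evalQ Qs (φ ∘ (true ∷_)) ∨ evalQ Qs (φ ∘ (false ∷_))
    ≡⟨ ∨-comm (evalQ Qs (φ ∘ (true ∷_))) _ ⟩
  evalQ Qs (φ ∘ (false ∷_)) ∨ evalQ Qs (φ ∘ (true ∷_))
    ∎
evalQ-∘-map-not (∀q ∷ Qs) φ = begin
  evalQ Qs (φ ∘ map not ∘ (false ∷_)) ∧ evalQ Qs (φ ∘ map not ∘ (true ∷_))
    ≡⟨ cong₂ _∧_ (evalQ-∘-map-not Qs (φ ∘ (true ∷_))) (evalQ-∘-map-not Qs (φ ∘ (false ∷_))) ⟩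
  evalQ Qs (φ ∘ (true ∷_)) ∧ evalQ Qs (φ ∘ (false ∷_))
    ≡⟨ ∧-comm (evalQ Qs (φ ∘ (true ∷_))) _ ⟩
  evalQ Qs (φ ∘ (false ∷_)) ∧ evalQ Qs (φ ∘ (true ∷_))
    ∎

evalArg-complement : ∀ {n} (f t : Bool) (σ : Vec Bool n) (a : Arg n) →
                     evalArg (not f) (not t) (map not σ) a ≡ not (evalArg f t σ a)
evalArg-complement f t σ (inj₁ i)     = lookup-map i not σ
evalArg-complement f t σ (inj₂ false) = refl
evalArg-complement f t σ (inj₂ true)  = refl

evalApp-complement : ∀ {𝒞 n} → All Complementive 𝒞 → (f t : Bool) (σ : Vec Bool n)
                     (a : Application 𝒞 n) →
                     evalApp (not f) (not t) (map not σ) a ≡ evalApp f t σ a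
evalApp-complement comp f t σ (app (m , C) C∈𝒞 as) = begin
  C (map (evalArg (not f) (not t) (map not σ)) as)
    ≡⟨ cong C (map-cong (evalArg-complement f t σ) as) ⟩
  C (map (not ∘ evalArg f t σ) as)
    ≡⟨ cong C (map-∘ not (evalArg f t σ) as) ⟩
  C (map not (map (evalArg f t σ) as))
    ≡⟨ sym (All.lookup comp C∈𝒞 (map (evalArg f t σ) as)) ⟩
  C (map (evalArg f t σ) as)
    ∎

evalS-complement : ∀ {𝒞 n} → All Complementive 𝒞 → (S : ConstraintSet 𝒞 n)
                   (f t : Bool) (σ : Vec Bool n) →
                   evalS S (not f) (not t) (map not σ) ≡ evalS S f t σ
evalS-complement comp []      f t σ = refl
evalS-complement comp (a ∷ S) f t σ =
  cong₂ _∧_ (evalApp-complement comp f t σ a) (evalS-complement comp S f t σ)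

corollary1 : (𝒞 : List Constr) → All Complementive 𝒞 →
    (n : ℕ) (S : ConstraintSet 𝒞 n) (Qs : Vec Quantifier n) →
    (evalQ Qs (evalS S false true) ≡ true) ⇔ (evalQ Qs (evalS S true false) ≡ true)
corollary1 𝒞 comp n S Qs = mk⇔ (trans (sym swap)) (trans swap)
  where
  swap : evalQ Qs (evalS S false true) ≡ evalQ Qs (evalS S true false)
  swap = begin
    evalQ Qs (evalS S false true)
      ≡⟨ evalQ-∘-map-not Qs (evalS S false true) ⟨
    evalQ Qs (evalS S false true ∘ map not)
      ≡⟨ evalQ-cong Qs (evalS-complement comp S true false) ⟩
    evalQ Qs (evalS S true false)
      ∎
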